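{- Let $G$ be a Hurwitz galaxy with marked vertex $x_0$ and distance labeling $\delta$. Then the graph $\Theta(G)$ is a tree, and for every vertex $v$ of $\Theta(G)$, $\delta(v)$ equals the graph distance from $x_0$ to $v$ in $\Theta(G)$.
   Context: Hurwitz galaxies. - A bicolored map is a connected graph cellularly embedded in a compact oriented surface $\mathcal S_g$ (up to orientation-preserving homeomorphism), with faces colored black/white so that adjacent faces differ. Its canonical orientation puts the black face on the left of each edge. - An $(r+1)$-galaxy ($r\ge2$) is such a map whose directed cycles all have length divisible by $r+1$. It is marked if it has a distinguished vertex $x_0$. - Vertex colors $c(x)\in\{0,\dots,r\}$ are the lengths mod $r+1$ of directed paths from $x_0$. The size is the number of edges whose origin has a given color. The half-degree of a vertex is half its degree. - A Hurwitz galaxy is a marked $(r+1)$-galaxy of some size $d$ in which every vertex has half-degree $1$, except exactly $r$ vertices of half-degree $2$, one of each color $1,\dots,r$. Distances and geodesic edges. - $\delta(x)$ is the length of a shortest directed path from $x_0$ to $x$. - An edge $u\to v$ is geodesic if $\delta(v)=\delta(u)+1$. Every non-marked vertex has in-degree $1$ or $2$ and at least one incoming geodesic edge. The graph $\Theta(G)$. - Splitting a vertex $v$ with two incoming geodesic edges replaces $v$ by two new vertices, each carrying one of the incoming geodesic edges together with the outgoing edge that follows it in clockwise order around $v$. Both new vertices keep the label $\delta(v)$. - $\Theta(G)$ is the graph obtained from $G$ by splitting every vertex with two incoming geodesic edges and then deleting all non-geodesic edges. -}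

module Defs where

open import Data.Nat using (ℕ; zero; suc; _+_; _≤_; _%_; ⌊_/2⌋)
open import Data.Nat.Divisibility using (_∣_)
open import Data.Fin using (Fin)
open import Data.Fin.Properties using (_≟_)
open import Data.Fin.Permutation using (Permutation′; _⟨$⟩ʳ_; _⟨$⟩ˡ_)
open import Data.Vec using (allFin; count)
open import Data.List using (List; []; _∷_; length)
open import Data.List.Relation.Unary.Unique.Propositional using (Unique)
open import Data.Product using (Σ; ∃; _×_; _,_)
open import Data.Sum using (_⊎_; inj₁; inj₂)
open import Data.Empty using (⊥)
open import Data.Unit using (⊤)
open import Relation.Nullary using (¬_)
open import Relation.Binary.PropositionalEquality using (_≡_; _≢_)
open import Function.Bundles using (_⇔_)

iter : ∀ {A : Set} → (A → A) → ℕ → A → A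
iter f zero    a = a
iter f (suc k) a = f (iter f k a)

-- Undirected multigraphs given by an edge relation.
-- Edges are Fin n; R e a b means: edge e goes from a to b.

module UGraph {V : Set} {n : ℕ} (R : Fin n → V → V → Set) where

  data Walk : V → V → Set where
    nil : ∀ {a} → Walk a a
    fwd : ∀ {a b c} (e : Fin n) → R e a b → Walk b c → Walk a c
    bwd : ∀ {a b c} (e : Fin n) → R e b a → Walk b c → Walk a c

  len : ∀ {a b} → Walk a b → ℕ
  len nil         = zero
  len (fwd _ _ w) = suc (len w)
  len (bwd _ _ w) = suc (len w)

  edges : ∀ {a b} → Walk a b → List (Fin n)
  edges nil         = []
  edges (fwd e _ w) = e ∷ edges w
  edges (bwd e _ w) = e ∷ edges w

  -- vertices visited, the final vertex excluded
  verts : ∀ {a b} → Walk a b → List V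
  verts nil                 = []
  verts {a} (fwd _ _ w) = a ∷ verts w
  verts {a} (bwd _ _ w) = a ∷ verts w

  IsCycle : ∀ {a} → Walk a a → Set
  IsCycle w = (1 ≤ len w) × Unique (edges w) × Unique (verts w)

  -- the vertex set is given by a predicate Vtx on V
  Connected : (Vtx : V → Set) → Set
  Connected Vtx = ∀ a b → Vtx a → Vtx b → Walk a b

  Acyclic : Set
  Acyclic = ∀ a (w : Walk a a) → IsCycle w → ⊥

  IsTree : (Vtx : V → Set) → Set
  IsTree Vtx = Connected Vtx × Acyclic

  IsGraphDist : V → V → ℕ → Set
  IsGraphDist a b d = (Σ (Walk a b) λ w → len w ≡ d) × (∀ (w : Walk a b) → d ≤ len w)

-- Edges: Fin nE, each edge oriented canonically (black face on its left).
-- β e : the edge following e along the boundary of the black face of e.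
-- ω e : the edge following e along the boundary of the white face of e.  The incoming edges at a
-- vertex are cyclically ordered by ρ = ω⁻¹ ∘ β, and the vertices are
-- exactly the cycles of ρ.
-- Black faces = cycles of β, white faces = cycles of ω.

record BicoloredMap : Set where
  field
    nE nV : ℕ
    β ω   : Permutation′ nE
    head  : Fin nE → Fin nV

  ρ : Fin nE → Fin nE
  ρ e = ω ⟨$⟩ˡ (β ⟨$⟩ʳ e)

  tail : Fin nE → Fin nV
  tail e = head (β ⟨$⟩ˡ e)

  Arc : Fin nE → Fin nV → Fin nV → Set
  Arc e a b = (tail e ≡ a) × (head e ≡ b)

  field
    head-surj : ∀ v → ∃ λ e → head e ≡ v
    head-rot  : ∀ e e′ → (head e ≡ head e′) ⇔ (∃ λ k → iter ρ k e ≡ e′)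
    connected : UGraph.Connected Arc (λ _ → ⊤)

module OnMap (M : BicoloredMap) where
  open BicoloredMap M

  data DPath (x : Fin nV) : Fin nV → ℕ → Set where
    here : DPath x x zero
    step : ∀ {k} (e : Fin nE) → DPath x (tail e) k → DPath x (head e) (suc k)

  IsGalaxy : ℕ → Set
  IsGalaxy r = ∀ x k → DPath x x k → suc r ∣ k

  inDeg outDeg degree halfDegree : Fin nV → ℕ
  inDeg  v = count (λ e → head e ≟ v) (allFin nE)
  outDeg v = count (λ e → tail e ≟ v) (allFin nE)
  degree v = inDeg v + outDeg v
  halfDegree v = ⌊ degree v /2⌋

  module Marked (r : ℕ) (x₀ : Fin nV) where

    HasColor : Fin nV → ℕ → Set
    HasColor x c = ∃ λ k → DPath x₀ x k × k % suc r ≡ c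

    IsDelta : Fin nV → ℕ → Set
    IsDelta x d = DPath x₀ x d × (∀ k → DPath x₀ x k → d ≤ k)

    Geodesic : Fin nE → Set
    Geodesic e = ∃ λ d → IsDelta (tail e) d × IsDelta (head e) (suc d)

    TwoIn : Fin nV → Set
    TwoIn v = ∃ λ e₁ → ∃ λ e₂ → e₁ ≢ e₂ × head e₁ ≡ v × head e₂ ≡ v
                                 × Geodesic e₁ × Geodesic e₂

    -- Vertices of Θ(G): inj₁ v for an unsplit vertex v, and inj₂ e for
    -- the copy (of head e) obtained by splitting head e, carrying the
    -- incoming geodesic edge e and the outgoing edge following e in
    -- clockwise order around head e, namely β e.
    ΘV : Set
    ΘV = Fin nV ⊎ Fin nE

    IsΘVertex : ΘV → Set
    IsΘVertex (inj₁ v) = ¬ TwoIn v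
    IsΘVertex (inj₂ e) = Geodesic e × TwoIn (head e)

    -- the underlying vertex of G (δ of a copy is δ of the split vertex)
    under : ΘV → Fin nV
    under (inj₁ v) = v
    under (inj₂ e) = head e

    ΘTail : Fin nE → ΘV → Set
    ΘTail e a = (¬ TwoIn (tail e) × a ≡ inj₁ (tail e))
              ⊎ (∃ λ e′ → Geodesic e′ × TwoIn (tail e) × head e′ ≡ tail e
                          × β ⟨$⟩ʳ e′ ≡ e × a ≡ inj₂ e′)

    ΘHead : Fin nE → ΘV → Set
    ΘHead e b = (¬ TwoIn (head e) × b ≡ inj₁ (head e))
              ⊎ (TwoIn (head e) × b ≡ inj₂ e)

    ΘArc : Fin nE → ΘV → ΘV → Set
    ΘArc e a b = Geodesic e × ΘTail e a × ΘHead e b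

record IsHurwitzGalaxy (M : BicoloredMap) (r : ℕ) (x₀ : Fin (BicoloredMap.nV M)) : Set where
  open BicoloredMap M
  open OnMap M
  open Marked r x₀
  field
    r≥2     : 2 ≤ r
    galaxy  : IsGalaxy r
    hd-1    : ∀ x → halfDegree x ≢ 2 → halfDegree x ≡ 1
    hd-2-col : ∀ x → halfDegree x ≡ 2 → ∃ λ c → 1 ≤ c × c ≤ r × HasColor x c
    hd-2-one : ∀ c → 1 ≤ c → c ≤ r →
                 ∃ λ x → halfDegree x ≡ 2 × HasColor x c
                         × (∀ y → halfDegree y ≡ 2 → HasColor y c → y ≡ x)

module Submission where

-- The proof only uses that every vertex of a Hurwitz galaxy has half-degree
-- at most 2.  Since β maps the edges entering a vertex injectively to the
-- edges leaving it, no vertex has three incoming edges; hence splitting the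
-- vertices with two incoming geodesic edges leaves every vertex of Θ(G)
-- with at most one incoming arc, and every arc of Θ(G) raises δ by one.

open import Defs
open import Data.Nat using (ℕ; zero; suc; _+_; _≤_; _<_; z≤n; s≤s; ⌊_/2⌋)
open import Data.Nat.Properties
open import Data.Fin using (Fin; toℕ)
import Data.Fin.Properties as Fin
open import Data.Fin.Permutation using (Permutation′; _⟨$⟩ʳ_; _⟨$⟩ˡ_; inverseˡ; inverseʳ)
open import Data.Vec using (Vec; []; _∷_; count; allFin)
open import Data.Vec.Membership.Propositional using () renaming (_∈_ to _∈ᵛ_)
open import Data.Vec.Membership.Propositional.Properties using (∈-allFin⁺)
import Data.Vec.Relation.Unary.Any as VAny
open import Data.List using (List; []; _∷_; length)
open import Data.List.Relation.Unary.All using (All; []; _∷_)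
import Data.List.Relation.Unary.All as All
open import Data.List.Relation.Unary.AllPairs using ([]; _∷_)
open import Data.List.Relation.Unary.Unique.Propositional using (Unique)
open import Data.List.Membership.Propositional using (_∈_)
open import Data.List.Relation.Unary.Any using (here; there)
open import Data.Product using (Σ; ∃; _×_; _,_; proj₁; proj₂)
open import Data.Sum using (inj₁; inj₂)
open import Data.Empty using (⊥; ⊥-elim)
open import Data.Unit using (tt)
open import Function using (_∘_)
open import Function.Bundles using (Injection)
open import Function.Properties.Inverse using (↔⇒↣)
open import Level using (0ℓ)
open import Relation.Nullary using (Dec; yes; no)
open import Relation.Nullary.Decidable using (_×-dec_; ¬?)
open import Relation.Unary using (Pred; Decidable)
open import Relation.Binary.Definitions using (DecidableEquality)
open import Relation.Binary.PropositionalEquality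

module Counting {A : Set} (_≟_ : DecidableEquality A) where

  count-mono : ∀ {n} {P Q : Pred A 0ℓ} (P? : Decidable P) (Q? : Decidable Q)
    → (∀ {x} → P x → Q x) → (xs : Vec A n) → count P? xs ≤ count Q? xs
  count-mono P? Q? P⇒Q [] = z≤n
  count-mono P? Q? P⇒Q (x ∷ xs) with P? x | Q? x
  ... | yes _  | yes _ = s≤s (count-mono P? Q? P⇒Q xs)
  ... | yes px | no ¬qx = ⊥-elim (¬qx (P⇒Q px))
  ... | no _   | yes _ = m≤n⇒m≤1+n (count-mono P? Q? P⇒Q xs)
  ... | no _   | no _ = count-mono P? Q? P⇒Q xs

  count-remove : ∀ {n} {P : Pred A 0ℓ} (P? : Decidable P) {a} {xs : Vec A n}
    → a ∈ᵛ xs → P a → suc (count (λ x → P? x ×-dec ¬? (x ≟ a)) xs) ≤ count P? xs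
  count-remove P? {a} {a ∷ xs} (VAny.here refl) pa with P? a | a ≟ a
  ... | yes _ | yes _ = s≤s (count-mono _ P? proj₁ xs)
  ... | yes _ | no a≢a = ⊥-elim (a≢a refl)
  ... | no ¬pa | _ = ⊥-elim (¬pa pa)
  count-remove P? {a} {x ∷ xs} (VAny.there a∈xs) pa with P? x | x ≟ a
  ... | yes _ | yes _ = m≤n⇒m≤1+n (count-remove P? a∈xs pa)
  ... | yes _ | no _ = s≤s (count-remove P? a∈xs pa)
  ... | no _ | _ = count-remove P? a∈xs pa

  distinct-witnesses≤count : ∀ {n} {P : Pred A 0ℓ} (P? : Decidable P) (xs : Vec A n)
    (ws : List A) → Unique ws → All P ws → All (_∈ᵛ xs) ws → length ws ≤ count P? xs
  distinct-witnesses≤count P? xs [] _ _ _ = z≤n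
  distinct-witnesses≤count P? xs (w ∷ ws) (w∉ws ∷ uniq) (pw ∷ pws) (w∈xs ∷ ws⊆xs) =
    ≤-trans (s≤s rest) (count-remove P? w∈xs pw)
    where
      rest : length ws ≤ count (λ x → P? x ×-dec ¬? (x ≟ w)) xs
      rest = distinct-witnesses≤count (λ x → P? x ×-dec ¬? (x ≟ w)) xs ws uniq
               (All.zipWith (λ (p , w≢x) → p , λ x≡w → w≢x (sym x≡w)) (pws , w∉ws)) ws⊆xs

least-witness : {P : Pred ℕ 0ℓ} → Decidable P → ∀ k → P k → ∃ λ d → P d × (∀ j → P j → d ≤ j)
least-witness P? zero p = 0 , p , λ _ _ → z≤n
least-witness P? (suc k) p with P? 0
... | yes p₀ = 0 , p₀ , λ _ _ → z≤n
... | no ¬p₀ with least-witness (λ j → P? (suc j)) k p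
... | d , pd , minimal = suc d , pd , λ { zero p₀ → ⊥-elim (¬p₀ p₀) ; (suc j) pj → s≤s (minimal j pj) }

module Walks {V : Set} {n : ℕ} (R : Fin n → V → V → Set) where
  open UGraph R

  infixr 5 _++ʷ_
  _++ʷ_ : ∀ {a b c} → Walk a b → Walk b c → Walk a c
  nil         ++ʷ w′ = w′
  fwd e arc w ++ʷ w′ = fwd e arc (w ++ʷ w′)
  bwd e arc w ++ʷ w′ = bwd e arc (w ++ʷ w′)

  len-++ʷ : ∀ {a b c} (w : Walk a b) (w′ : Walk b c) → len (w ++ʷ w′) ≡ len w + len w′
  len-++ʷ nil         w′ = refl
  len-++ʷ (fwd e _ w) w′ = cong suc (len-++ʷ w w′)
  len-++ʷ (bwd e _ w) w′ = cong suc (len-++ʷ w w′)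

  reverse : ∀ {a b} → Walk a b → Walk b a
  reverse nil           = nil
  reverse (fwd e arc w) = reverse w ++ʷ bwd e arc nil
  reverse (bwd e arc w) = reverse w ++ʷ fwd e arc nil

module Levelled {V : Set} {n : ℕ} (R : Fin n → V → V → Set) (level : V → ℕ)
    (rise : ∀ {e a b} → R e a b → level b ≡ suc (level a))
    (in-unique : ∀ {e e′ a a′ b} → R e a b → R e′ a′ b → e ≡ e′) where
  open UGraph R
  open Walks R

  -- Each step changes the level by one, so a walk of length ℓ from a
  -- reaches at most level ℓ + level a.
  level-bound : ∀ {a c} (w : Walk a c) → level c ≤ len w + level a
  level-bound nil = ≤-refl
  level-bound (fwd e arc w) = ≤-trans (level-bound w) (≤-reflexive (begin
    len w + level _       ≡⟨ cong (len w +_) (rise arc) ⟩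
    len w + suc (level _) ≡⟨ +-suc (len w) _ ⟩
    suc (len w + level _) ∎))
    where open ≡-Reasoning
  level-bound (bwd e arc w) = ≤-trans (level-bound w)
    (≤-trans (+-monoʳ-≤ (len w) (≤-trans (n≤1+n _) (≤-reflexive (sym (rise arc))))) (n≤1+n _))

  data Ascent : ∀ {a c} → Walk a c → Set where
    nil : ∀ {a} → Ascent (nil {a})
    fwd : ∀ {a b c} e (arc : R e a b) {w : Walk b c} → Ascent w → Ascent (fwd e arc w)

  data Valley : ∀ {a c} → Walk a c → Set where
    ascent : ∀ {a c} {w : Walk a c} → Ascent w → Valley w
    bwd    : ∀ {a b c} e (arc : R e b a) {w : Walk b c} → Valley w → Valley (bwd e arc w)

  -- A forward step into b followed by a backward step out of b uses two
  -- arcs ending at b, i.e. the same edge twice; so a walk without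
  -- repeated edges is a valley.
  valley : ∀ {a c} (w : Walk a c) → Unique (edges w) → Valley w
  valley nil _ = ascent nil
  valley (bwd e arc w) (_ ∷ uniq) = bwd e arc (valley w uniq)
  valley (fwd e arc w) (_ ∷ uniq) with valley w uniq
  ... | ascent up = ascent (fwd e arc up)
  valley (fwd e arc _) ((e≢e₂ ∷ _) ∷ _) | bwd e₂ arc₂ _ = ⊥-elim (e≢e₂ (in-unique arc arc₂))

  ascent-level : ∀ {a c} {w : Walk a c} → Ascent w → level c ≡ len w + level a
  ascent-level nil = refl
  ascent-level (fwd e arc {w} up) = begin
    level _               ≡⟨ ascent-level up ⟩
    len w + level _       ≡⟨ cong (len w +_) (rise arc) ⟩
    len w + suc (level _) ≡⟨ +-suc (len w) _ ⟩
    suc (len w + level _) ∎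
    where open ≡-Reasoning

  EntersAt : ∀ {b c} → Walk b c → Set
  EntersAt {c = c} w = ∃ λ e → ∃ λ b → R e b c × e ∈ edges w

  ascent-enters : ∀ {a b c} e (arc : R e a b) {w : Walk b c} → Ascent w → EntersAt (fwd e arc w)
  ascent-enters e arc nil = e , _ , arc , here refl
  ascent-enters e arc (fwd e₂ arc₂ up) with ascent-enters e₂ arc₂ up
  ... | e′ , b′ , arc′ , e′∈w = e′ , b′ , arc′ , there e′∈w

  valley-enters : ∀ {b c} {w : Walk b c} → Valley w → level b < level c → EntersAt w
  valley-enters (ascent nil) b<c = ⊥-elim (<-irrefl refl b<c)
  valley-enters (ascent (fwd e arc up)) _ = ascent-enters e arc up
  valley-enters (bwd e arc v) b<c
    with valley-enters v (≤-trans (≤-reflexive (sym (rise arc))) (≤-trans (n≤1+n _) b<c))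
  ... | e′ , b′ , arc′ , e′∈w = e′ , b′ , arc′ , there e′∈w

  -- A cycle is a closed valley.  A pure ascent cannot be closed and
  -- non-empty; otherwise the first step goes back along an arc into the
  -- base point, and the closing ascent must re-enter the base point along
  -- that same edge.
  acyclic : Acyclic
  acyclic a w (len≥1 , uniq , _) with valley w uniq
  ... | ascent up = closed-ascent len≥1 (ascent-level up)
    where
      closed-ascent : 1 ≤ len w → level a ≡ len w + level a → ⊥
      closed-ascent _ eq with len w
      ... | suc k = m≢1+n+m (level a) eq
  acyclic a .(bwd e arc _) (_ , (e∉w ∷ _) , _) | bwd e arc v
    with valley-enters v (≤-reflexive (sym (rise arc)))
  ... | e′ , _ , arc′ , e′∈w = All.lookup e∉w e′∈w (in-unique arc arc′)

  module Rooted (Vtx : V → Set) (root : V) (root-level : level root ≡ 0)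
      (level-0 : ∀ v → Vtx v → level v ≡ 0 → v ≡ root)
      (parent : ∀ v d → Vtx v → level v ≡ suc d → ∃ λ u → ∃ λ e → Vtx u × R e u v) where

    -- Following parents down to the root gives a walk of length level v.
    walk-from-root : ∀ d v → Vtx v → level v ≡ d → Σ (Walk root v) λ w → len w ≡ d
    walk-from-root zero v v∈ lv≡0 rewrite level-0 v v∈ lv≡0 = nil , refl
    walk-from-root (suc d) v v∈ lv≡1+d with parent v d v∈ lv≡1+d
    ... | u , e , u∈ , arc with walk-from-root d u u∈ (suc-injective (trans (sym (rise arc)) lv≡1+d))
    ... | w , len-w = w ++ʷ fwd e arc nil , (begin
      len (w ++ʷ fwd e arc nil) ≡⟨ len-++ʷ w (fwd e arc nil) ⟩
      len w + 1                 ≡⟨ +-comm (len w) 1 ⟩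
      suc (len w)               ≡⟨ cong suc len-w ⟩
      suc d                     ∎)
      where open ≡-Reasoning

    connected : Connected Vtx
    connected a b a∈ b∈ =
      reverse (proj₁ (walk-from-root _ a a∈ refl)) ++ʷ proj₁ (walk-from-root _ b b∈ refl)

    tree : IsTree Vtx
    tree = connected , acyclic

    distance : ∀ v → Vtx v → IsGraphDist root v (level v)
    distance v v∈ = walk-from-root _ v v∈ refl , λ w →
      ≤-trans (level-bound w) (≤-reflexive (trans (cong (len w +_) root-level) (+-identityʳ (len w))))

iter-+ : ∀ {A : Set} (f : A → A) m k x → iter f (m + k) x ≡ iter f m (iter f k x)
iter-+ f zero    k x = refl
iter-+ f (suc m) k x = cong f (iter-+ f m k x)

module Orbits {n : ℕ} (π : Permutation′ n) where

  π̂ : Fin n → Fin n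
  π̂ x = π ⟨$⟩ʳ x

  iter-injective : ∀ k {x y} → iter π̂ k x ≡ iter π̂ k y → x ≡ y
  iter-injective zero    eq = eq
  iter-injective (suc k) eq = iter-injective k (Injection.injective (↔⇒↣ π) eq)

  -- By pigeonhole two of x, π x, …, πⁿ x coincide; cancelling the
  -- smaller power shows that some positive power of π fixes x.
  orbit-returns : ∀ x → ∃ λ k → iter π̂ (suc k) x ≡ x
  orbit-returns x with Fin.pigeonhole (n<1+n n) (λ i → iter π̂ (toℕ i) x)
  ... | i , j , i<j , πⁱx≡πʲx with m≤n⇒∃[o]m+o≡n i<j
  ... | k , 1+i+k≡j = k , sym (iter-injective (toℕ i) (begin
    iter π̂ (toℕ i) x                   ≡⟨ πⁱx≡πʲx ⟩
    iter π̂ (toℕ j) x                   ≡⟨ cong (λ m → iter π̂ m x) (sym 1+i+k≡j) ⟩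
    iter π̂ (suc (toℕ i + k)) x         ≡⟨ cong (λ m → iter π̂ m x) (sym (+-suc (toℕ i) k)) ⟩
    iter π̂ (toℕ i + suc k) x           ≡⟨ iter-+ π̂ (toℕ i) (suc k) x ⟩
    iter π̂ (toℕ i) (iter π̂ (suc k) x)  ∎))
    where open ≡-Reasoning

module MapPaths (M : BicoloredMap) where
  open BicoloredMap M
  open OnMap M
  open Orbits β using () renaming (π̂ to β̂; orbit-returns to β-orbit-returns)

  tail-β : ∀ e → tail (β̂ e) ≡ head e
  tail-β e = cong head (inverseˡ β)

  infixr 5 _++ᵈ_
  _++ᵈ_ : ∀ {x y z k m} → DPath x y k → DPath y z m → DPath x z (m + k)
  p ++ᵈ here     = p
  p ++ᵈ step e q = step e (p ++ᵈ q)

  face-path : ∀ e k → DPath (head e) (head (iter β̂ k e)) k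
  face-path e zero    = here
  face-path e (suc k) = step (β̂ (iter β̂ k e))
    (subst (λ y → DPath (head e) y k) (sym (tail-β (iter β̂ k e))) (face-path e k))

  -- Since the black face of e is a closed directed cycle, the head of
  -- every edge is joined to its tail by a directed path.
  edge-reversible : ∀ e → ∃ λ k → DPath (head e) (tail e) k
  edge-reversible e with β-orbit-returns e
  ... | k , βᵏ⁺¹e≡e = k , subst (λ y → DPath (head e) y k) (cong head βᵏe≡β⁻¹e) (face-path e k)
    where
      βᵏe≡β⁻¹e : iter β̂ k e ≡ β ⟨$⟩ˡ e
      βᵏe≡β⁻¹e = trans (sym (inverseˡ β)) (cong (β ⟨$⟩ˡ_) βᵏ⁺¹e≡e)

  walk⇒path : ∀ {x y} → UGraph.Walk Arc x y → ∃ λ k → DPath x y k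
  walk⇒path UGraph.nil = 0 , here
  walk⇒path (UGraph.fwd e (refl , refl) w) =
    _ , step e here ++ᵈ proj₂ (walk⇒path w)
  walk⇒path (UGraph.bwd e (refl , refl) w) =
    _ , proj₂ (edge-reversible e) ++ᵈ proj₂ (walk⇒path w)

  path? : ∀ x y k → Dec (DPath x y k)
  path? x y zero with y Fin.≟ x
  ... | yes refl = yes here
  ... | no y≢x   = no λ { here → y≢x refl }
  path? x y (suc k) with Fin.any? (λ e → (head e Fin.≟ y) ×-dec path? x (tail e) k)
  ... | yes (e , refl , p) = yes (step e p)
  ... | no ¬last-step      = no λ { (step e p) → ¬last-step (e , refl , p) }

  -- β sends the edges entering v injectively to edges leaving v, so three
  -- distinct incoming edges force half-degree at least 3.
  three-incoming⇒halfDegree≥3 : ∀ v a b c → a ≢ b → a ≢ c → b ≢ c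
    → head a ≡ v → head b ≡ v → head c ≡ v → 3 ≤ halfDegree v
  three-incoming⇒halfDegree≥3 v a b c a≢b a≢c b≢c ha hb hc =
    ⌊n/2⌋-mono (+-mono-≤ (three-witnesses (λ e → head e Fin.≟ v) a b c a≢b a≢c b≢c ha hb hc)
                         (three-witnesses (λ e → tail e Fin.≟ v) (β̂ a) (β̂ b) (β̂ c)
                            (β̂-cong a≢b) (β̂-cong a≢c) (β̂-cong b≢c)
                            (trans (tail-β a) ha) (trans (tail-β b) hb) (trans (tail-β c) hc)))
    where
      open Counting Fin._≟_
      three-witnesses : {P : Pred (Fin nE) 0ℓ} (P? : Decidable P) (a b c : Fin nE)
        → a ≢ b → a ≢ c → b ≢ c → P a → P b → P c → 3 ≤ count P? (allFin nE)
      three-witnesses P? a b c a≢b a≢c b≢c pa pb pc =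
        distinct-witnesses≤count P? (allFin nE) (a ∷ b ∷ c ∷ [])
          ((a≢b ∷ a≢c ∷ []) ∷ (b≢c ∷ []) ∷ [] ∷ [])
          (pa ∷ pb ∷ pc ∷ []) (∈-allFin⁺ a ∷ ∈-allFin⁺ b ∷ ∈-allFin⁺ c ∷ [])
      β̂-cong : ∀ {x y} → x ≢ y → β̂ x ≢ β̂ y
      β̂-cong x≢y βx≡βy = x≢y (Injection.injective (↔⇒↣ β) βx≡βy)

module Distances (M : BicoloredMap) (r : ℕ) (x₀ : Fin (BicoloredMap.nV M)) where
  open BicoloredMap M
  open OnMap M
  open Marked r x₀
  open MapPaths M

  -- The map is connected, so every vertex is reached from x₀ by a
  -- directed path, and the shortest such path defines δ.
  δ-exists : ∀ x → ∃ λ d → IsDelta x d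
  δ-exists x with walk⇒path (connected x₀ x tt tt)
  ... | k , p = least-witness (path? x₀ x) k p

  δ : Fin nV → ℕ
  δ x = proj₁ (δ-exists x)

  δ-spec : ∀ x → IsDelta x (δ x)
  δ-spec x = proj₂ (δ-exists x)

  δ-unique : ∀ {x d d′} → IsDelta x d → IsDelta x d′ → d ≡ d′
  δ-unique (p , minimal) (p′ , minimal′) = ≤-antisym (minimal _ p′) (minimal′ _ p)

  δ-x₀ : δ x₀ ≡ 0
  δ-x₀ = δ-unique (δ-spec x₀) (here , λ _ _ → z≤n)

  δ≡0⇒x₀ : ∀ x → δ x ≡ 0 → x ≡ x₀
  δ≡0⇒x₀ x δx≡0 with subst (DPath x₀ x) δx≡0 (proj₁ (δ-spec x))
  ... | here = refl

  geodesic⇒δ : ∀ {e} → Geodesic e → δ (head e) ≡ suc (δ (tail e))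
  geodesic⇒δ {e} (d , δ-tail , δ-head) =
    trans (δ-unique (δ-spec (head e)) δ-head) (cong suc (δ-unique δ-tail (δ-spec (tail e))))

  δ⇒geodesic : ∀ {e} → δ (head e) ≡ suc (δ (tail e)) → Geodesic e
  δ⇒geodesic {e} eq = δ (tail e) , δ-spec (tail e) , subst (IsDelta (head e)) eq (δ-spec (head e))

  geodesic? : ∀ e → Dec (Geodesic e)
  geodesic? e with δ (head e) ≟ suc (δ (tail e))
  ... | yes eq = yes (δ⇒geodesic eq)
  ... | no neq = no λ g → neq (geodesic⇒δ g)

  twoIn? : ∀ v → Dec (TwoIn v)
  twoIn? v = Fin.any? λ e₁ → Fin.any? λ e₂ → ¬? (e₁ Fin.≟ e₂)
    ×-dec (head e₁ Fin.≟ v) ×-dec (head e₂ Fin.≟ v) ×-dec geodesic? e₁ ×-dec geodesic? e₂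

  last-edge-geodesic : ∀ {y d} → IsDelta y (suc d) → ∃ λ e → head e ≡ y × Geodesic e
  last-edge-geodesic {d = d} (step e p , minimal) =
    e , refl , d , (p , λ k q → ≤-pred (minimal (suc k) (step e q))) , (step e p , minimal)

module Theta (M : BicoloredMap) (r : ℕ) (x₀ : Fin (BicoloredMap.nV M))
             (halfDegree≤2 : ∀ v → OnMap.halfDegree M v ≤ 2) where
  open BicoloredMap M
  open OnMap M
  open Marked r x₀
  open MapPaths M
  open Distances M r x₀

  no-three-incoming : ∀ v a b c → a ≢ b → a ≢ c → b ≢ c
    → head a ≡ v → head b ≡ v → head c ≡ v → ⊥
  no-three-incoming v a b c a≢b a≢c b≢c ha hb hc =
    ≤⇒≯ (halfDegree≤2 v) (three-incoming⇒halfDegree≥3 v a b c a≢b a≢c b≢c ha hb hc)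

  -- At a split vertex both incoming edges are geodesic; in particular so
  -- is the edge preceding any outgoing edge e in clockwise order.
  preceding-geodesic : ∀ e → TwoIn (tail e) → Geodesic (β ⟨$⟩ˡ e)
  preceding-geodesic e (e₁ , e₂ , e₁≢e₂ , h₁ , h₂ , g₁ , g₂)
    with (β ⟨$⟩ˡ e) Fin.≟ e₁ | (β ⟨$⟩ˡ e) Fin.≟ e₂
  ... | yes refl | _        = g₁
  ... | no _     | yes refl = g₂
  ... | no ≢e₁   | no ≢e₂   = ⊥-elim (no-three-incoming (tail e) e₁ e₂ (β ⟨$⟩ˡ e)
                                e₁≢e₂ (≢e₁ ∘ sym) (≢e₂ ∘ sym) h₁ h₂ refl)

  level : ΘV → ℕ
  level v = δ (under v)

  tail-under : ∀ {e a} → ΘTail e a → under a ≡ tail e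
  tail-under (inj₁ (_ , refl))                          = refl
  tail-under (inj₂ (_ , _ , _ , head≡tail , _ , refl)) = head≡tail

  head-under : ∀ {e b} → ΘHead e b → under b ≡ head e
  head-under (inj₁ (_ , refl)) = refl
  head-under (inj₂ (_ , refl)) = refl

  arc-rise : ∀ {e a b} → ΘArc e a b → level b ≡ suc (level a)
  arc-rise {e} {a} {b} (g , t , h) = begin
    δ (under b)        ≡⟨ cong δ (head-under h) ⟩
    δ (head e)         ≡⟨ geodesic⇒δ g ⟩
    suc (δ (tail e))   ≡⟨ cong (suc ∘ δ) (tail-under t) ⟨
    suc (δ (under a))  ∎
    where open ≡-Reasoning

  -- Splitting leaves at most one incoming arc at each vertex of Θ(G): an
  -- unsplit vertex has at most one incoming geodesic edge, and each copy
  -- of a split vertex receives exactly one.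
  arc-in-unique : ∀ {e e′ a a′ b} → ΘArc e a b → ΘArc e′ a′ b → e ≡ e′
  arc-in-unique {e} {e′} (g , _ , inj₁ (¬two , refl)) (g′ , _ , inj₁ (_ , b≡)) with e Fin.≟ e′
  ... | yes e≡e′ = e≡e′
  ... | no e≢e′  = ⊥-elim (¬two (e , e′ , e≢e′ , refl , sym (cong under b≡) , g , g′))
  arc-in-unique (_ , _ , inj₁ (_ , refl)) (_ , _ , inj₂ (_ , ()))
  arc-in-unique (_ , _ , inj₂ (_ , refl)) (_ , _ , inj₁ (_ , ()))
  arc-in-unique (_ , _ , inj₂ (_ , refl)) (_ , _ , inj₂ (_ , refl)) = refl

  incoming-arc : ∀ v d → IsΘVertex v → level v ≡ suc d → ∃ λ e → Geodesic e × ΘHead e v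
  incoming-arc (inj₁ y) d ¬two δy≡1+d with last-edge-geodesic (subst (IsDelta y) δy≡1+d (δ-spec y))
  ... | e , refl , g = e , g , inj₁ (¬two , refl)
  incoming-arc (inj₂ e) d (g , two) _ = e , g , inj₂ (two , refl)

  -- Every vertex of Θ(G) of positive level has a parent: the Θ-vertex at
  -- which its incoming geodesic edge starts.
  parent : ∀ v d → IsΘVertex v → level v ≡ suc d
    → ∃ λ u → ∃ λ e → IsΘVertex u × ΘArc e u v
  parent v d v∈ level≡ with incoming-arc v d v∈ level≡
  ... | e , g , h with twoIn? (tail e)
  ... | no ¬two = inj₁ (tail e) , e , ¬two , g , inj₁ (¬two , refl) , h
  ... | yes two = inj₂ (β ⟨$⟩ˡ e) , e , (preceding-geodesic e two , two) ,
                  g , inj₂ (β ⟨$⟩ˡ e , preceding-geodesic e two , two , refl , inverseʳ β , refl) , h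

  -- Geodesic edges end at level ≥ 1, so x₀ is not split and is the only
  -- vertex of Θ(G) at level 0.
  root-vertex : IsΘVertex (inj₁ x₀)
  root-vertex (e₁ , _ , _ , h₁ , _ , g₁ , _) with trans (sym (geodesic⇒δ g₁)) (trans (cong δ h₁) δ-x₀)
  ... | ()

  level-0 : ∀ v → IsΘVertex v → level v ≡ 0 → v ≡ inj₁ x₀
  level-0 (inj₁ y) _ δy≡0 = cong inj₁ (δ≡0⇒x₀ y δy≡0)
  level-0 (inj₂ e) (g , _) δ≡0 with trans (sym (geodesic⇒δ g)) δ≡0
  ... | ()

hurwitz⇒halfDegree≤2 : ∀ {M r x₀} → IsHurwitzGalaxy M r x₀ → ∀ v → OnMap.halfDegree M v ≤ 2
hurwitz⇒halfDegree≤2 {M} H v with OnMap.halfDegree M v ≟ 2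
... | yes ≡2 = ≤-reflexive ≡2
... | no ≢2  = ≤-trans (≤-reflexive (IsHurwitzGalaxy.hd-1 H v ≢2)) (s≤s z≤n)

proposition3 : (M : BicoloredMap) (r : ℕ) (x₀ : Fin (BicoloredMap.nV M))
    → IsHurwitzGalaxy M r x₀
    → let open OnMap M
          open Marked r x₀
          open UGraph ΘArc
      in IsTree IsΘVertex
         × IsΘVertex (inj₁ x₀)
         × (∀ v → IsΘVertex v → ∃ λ d → IsDelta (under v) d × IsGraphDist (inj₁ x₀) v d)
proposition3 M r x₀ H =
  tree , root-vertex , λ v v∈ → level v , δ-spec (under v) , distance v v∈
  where
    open OnMap.Marked M r x₀
    open Distances M r x₀
    open Theta M r x₀ (hurwitz⇒halfDegree≤2 H)
    open Levelled ΘArc level arc-rise arc-in-unique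
    open Rooted IsΘVertex (inj₁ x₀) δ-x₀ level-0 parent
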